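{- Let $n\ge 4$ be even and let $\mathcal{L}$ be the special Laplacian matrix of the helm graph $H_n$. Then $\mathcal{L}$ is positive semidefinite.
   Context: Let $m=2n-1$. Notation: $\mathbf{1}$ is the all-ones vector in $\mathbb{R}^{n-1}$, $I$ the $(n-1)\times(n-1)$ identity. For $s=(s_1,\dots,s_\mu)'$, ${\rm Circ}(s')$ is the $\mu\times\mu$ circulant matrix whose first row is $s'$ and each subsequent row is the cyclic right shift of the previous one. For $n$ even and $k\in\{1,\dots,\frac n2-1\}$, let $c^k\in\mathbb{R}^{n-1}$ have $c^k_j=1$ if $j=k+1$ or $j=n-k$, and $c^k_j=0$ otherwise, and let $C_k:={\rm Circ}({c^k}')$. The special Laplacian of $H_n$ is the $m\times m$ matrix \[\mathcal{L} := \frac{1}{2}\begin{bmatrix} n-1 & -\mathbf{1}' & 0\\ -\mathbf{1}& (n+1) I & -2I\\ 0 & -2I & 2I\end{bmatrix}+\sum_{k=1}^{\frac{n}{2}-1}(-1)^{k}\frac{(n-1)-2k}{2}\begin{bmatrix} 0 & 0 & 0\\ 0& C_k & 0\\ 0 & 0 & 0\end{bmatrix},\] with blocks of sizes $1, n-1, n-1$.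
   Formalization: Positive semidefiniteness of $\mathcal{L}$ asks for a nonnegative quadratic form only at vectors with rational entries, rather than at all vectors with real entries. -}

module Defs where

open import Data.Nat as ℕ using (ℕ; zero; suc; _∸_; _<ᵇ_; _≡ᵇ_)
open import Data.Nat.DivMod using (_%_; _/_)
open import Data.Bool using (Bool; true; false; if_then_else_; _∨_)
open import Data.Fin using (Fin; toℕ)
open import Data.Integer using (ℤ; +_)
import Data.Integer as ℤ
open import Data.Rational using (ℚ; 0ℚ; ½; _≤_)
import Data.Rational as ℚ
open import Data.List using (List; map; foldr; applyUpTo)
open import Data.Product using (_×_)
open import Relation.Binary.PropositionalEquality using (_≡_)

ℕ→ℚ : ℕ → ℚ
ℕ→ℚ k = ℚ._/_ (+ k) 1

ℤ→ℚ : ℤ → ℚ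
ℤ→ℚ z = ℚ._/_ z 1

Matrix : ℕ → Set
Matrix m = Fin m → Fin m → ℚ

Σᶠ : (m : ℕ) → (Fin m → ℚ) → ℚ
Σᶠ zero    f = 0ℚ
Σᶠ (suc m) f = f Fin.zero ℚ.+ Σᶠ m (λ i → f (Fin.suc i))
  where import Data.Fin as Fin

quadForm : {m : ℕ} → Matrix m → (Fin m → ℚ) → ℚ
quadForm {m} A x = Σᶠ m (λ i → Σᶠ m (λ j → x i ℚ.* (A i j ℚ.* x j)))

IsPSD : {m : ℕ} → Matrix m → Set
IsPSD {m} A = (∀ i j → A i j ≡ A j i) × (∀ (x : Fin m → ℚ) → 0ℚ ≤ quadForm A x)

indic : Bool → ℚ
indic true  = ℚ.1ℚ
indic false = 0ℚ

-- entry (r,c) (0-indexed) of Circ(s') for a μ×μ circulant: s_{(c - r) mod μ}.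
-- C_k = Circ(c^k'), where c^k has ones at (1-indexed) positions k+1 and n-k,
-- i.e. 0-indexed positions k and n-1-k = μ-k.
Cₖ : (μ k r c : ℕ) → ℚ
Cₖ zero      k r c = 0ℚ
Cₖ (suc μ')  k r c =
  let μ = suc μ'
      d = (c ℕ.+ μ ∸ (r % μ)) % μ
  in indic ((d ≡ᵇ k) ∨ (d ≡ᵇ (μ ∸ k)))

sumℚ : List ℚ → ℚ
sumℚ = foldr ℚ._+_ 0ℚ

sgn : ℕ → ℚ
sgn zero    = ℚ.1ℚ
sgn (suc k) = ℚ.- sgn k

circPart : (n a b : ℕ) → ℚ
circPart n a b =
  sumℚ (map (λ k → sgn k ℚ.* (ℤ→ℚ ((+ (n ∸ 1)) ℤ.- (+ (2 ℕ.* k))) ℚ.* (½ ℚ.* Cₖ (n ∸ 1) k a b)))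
            (applyUpTo suc (n / 2 ∸ 1)))

-- entries of the block matrix [[n-1, -1', 0], [-1, (n+1)I, -2I], [0, -2I, 2I]]
-- Indices (0-indexed, natural numbers): 0 = hub; 1..n-1 = middle block (a = i-1);
-- n..2n-2 = last block (b = i-n).
data Block : Set where
  hub mid pend : Block

blockOf : ℕ → ℕ → Block
blockOf n zero = hub
blockOf n (suc i) = if i <ᵇ (n ∸ 1) then mid else pend

posIn : ℕ → ℕ → ℕ
posIn n zero = 0
posIn n (suc i) = if i <ᵇ (n ∸ 1) then i else i ∸ (n ∸ 1)

baseEntry : (n : ℕ) → Block → Block → ℕ → ℕ → ℚ
baseEntry n hub  hub  a b = ℕ→ℚ (n ∸ 1)
baseEntry n hub  mid  a b = ℚ.- ℚ.1ℚ
baseEntry n mid  hub  a b = ℚ.- ℚ.1ℚ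
baseEntry n mid  mid  a b = ℕ→ℚ (suc n) ℚ.* indic (a ≡ᵇ b)
baseEntry n mid  pend a b = ℚ.- (ℕ→ℚ 2 ℚ.* indic (a ≡ᵇ b))
baseEntry n pend mid  a b = ℚ.- (ℕ→ℚ 2 ℚ.* indic (a ≡ᵇ b))
baseEntry n pend pend a b = ℕ→ℚ 2 ℚ.* indic (a ≡ᵇ b)
baseEntry n _    _    a b = 0ℚ

circEntry : (n : ℕ) → Block → Block → ℕ → ℕ → ℚ
circEntry n mid mid a b = circPart n a b
circEntry n _   _   a b = 0ℚ

dimH : ℕ → ℕ
dimH n = 2 ℕ.* n ∸ 1

specialLaplacian : (n : ℕ) → Matrix (dimH n)
specialLaplacian n i j =
  let i' = toℕ i ; j' = toℕ j
      bi = blockOf n i' ; bj = blockOf n j'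
      a = posIn n i' ; b = posIn n j'
  in (½ ℚ.* baseEntry n bi bj a b) ℚ.+ circEntry n bi bj a b

module Submission where

-- Write n = 2h + 2 and μ = n − 1 = 2h + 1.  The special Laplacian is a sum of squares
--   𝓛 = Σ_{t<μ} u_t u_t' + ½ Σ_{r<μ} v_r v_r',
-- where u_t = e_{pend t} − e_{mid t} and v_r = e_hub − Σ_a σ(a,r) e_{mid a}, with
-- σ(a,r) = ±(−1)^(a+r), the sign being + exactly when r ≤ a.  The u_t account for the
-- pendant rows and columns and for I in the middle block.  Since μ is odd, Σ_r σ(a,r) = 1,
-- which produces the hub row, and Σ_r σ(a,r) σ(a+e,r) = (−1)^e (μ − 2e), which is μ for
-- e = 0 and, for 0 < e < μ, twice the coefficient (−1)^k (μ − 2k)/2 of the circulant C_k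
-- with e ∈ {k, μ − k}.

open import Defs
open import Algebra.Bundles using (CommutativeRing)
open import Data.Bool using (true; false; if_then_else_; T; _∨_)
open import Data.Bool.Properties using (∨-zeroʳ)
open import Data.Fin as Fin using (Fin; toℕ)
open import Data.Fin.Properties using (toℕ<n)
import Data.Integer as ℤ
import Data.Integer.Tactic.RingSolver as ℤ-Solver
open import Data.List using (map; applyUpTo)
open import Data.Nat using (ℕ; _≤_)
open import Data.Nat as ℕ using (zero; suc; _∸_; _≤ᵇ_; _<ᵇ_; _≡ᵇ_; z≤n; s≤s)
open import Data.Nat.Divisibility using (_∣_; divides)
open import Data.Nat.DivMod using (_%_; _/_; m*n/n≡m; m<n⇒m%n≡m; [m+n]%n≡m%n)
import Data.Nat.Properties as ℕP
import Data.Nat.Tactic.RingSolver as ℕ-Solver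
open import Data.Product using (_,_)
open import Data.Rational as ℚ using (ℚ; 0ℚ; 1ℚ; ½; _+_; _*_; -_; _-_)
import Data.Rational.Properties as ℚP
open import Data.Rational.Solver using (module +-*-Solver)
import Data.Rational.Unnormalised as ℚᵘ
import Data.Rational.Unnormalised.Properties as ℚᵘP
open import Data.Sum using (_⊎_; inj₁; inj₂)
open import Data.Unit using (tt)
open import Function using (_∘_)
open import Relation.Binary.PropositionalEquality
open import Relation.Nullary.Decidable using (yes; no; dec-true; dec-false)

open import Algebra.Properties.Semiring.Sum (CommutativeRing.semiring ℚP.+-*-commutativeRing)
  using ( sum; sum-syntax; sum-cong-≗; sum-replicate-zero
        ; ∑-distrib-+; ∑-comm; *-distribˡ-sum; *-distribʳ-sum)
open +-*-Solver using (solve; _:+_; _:*_; _:-_; :-_; con; _:=_)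

ℤ→ℚ-homo-+ : ∀ x y → ℤ→ℚ (x ℤ.+ y) ≡ ℤ→ℚ x + ℤ→ℚ y
ℤ→ℚ-homo-+ x y = ℚP.toℚᵘ-injective (begin
  ℚ.toℚᵘ (ℤ→ℚ (x ℤ.+ y))              ≈⟨ ℚP.toℚᵘ-fromℚᵘ (ℚᵘ.mkℚᵘ (x ℤ.+ y) 0) ⟩
  ℚᵘ.mkℚᵘ (x ℤ.+ y) 0                 ≈⟨ ℚᵘ.*≡* (unit-denominators x y) ⟩
  ℚᵘ.mkℚᵘ x 0 ℚᵘ.+ ℚᵘ.mkℚᵘ y 0        ≈⟨ ℚᵘP.+-cong (ℚᵘP.≃-sym (ℚP.toℚᵘ-fromℚᵘ (ℚᵘ.mkℚᵘ x 0)))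
                                                    (ℚᵘP.≃-sym (ℚP.toℚᵘ-fromℚᵘ (ℚᵘ.mkℚᵘ y 0))) ⟩
  ℚ.toℚᵘ (ℤ→ℚ x) ℚᵘ.+ ℚ.toℚᵘ (ℤ→ℚ y)  ≈⟨ ℚᵘP.≃-sym (ℚP.toℚᵘ-homo-+ (ℤ→ℚ x) (ℤ→ℚ y)) ⟩
  ℚ.toℚᵘ (ℤ→ℚ x + ℤ→ℚ y)              ∎)
  where
  open ℚᵘP.≃-Reasoning
  unit-denominators : ∀ x y → (x ℤ.+ y) ℤ.* ℤ.+ 1 ≡ (x ℤ.* ℤ.+ 1 ℤ.+ y ℤ.* ℤ.+ 1) ℤ.* ℤ.+ 1
  unit-denominators = ℤ-Solver.solve-∀

ℤ→ℚ-homo‿- : ∀ x → ℤ→ℚ (ℤ.- x) ≡ - ℤ→ℚ x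
ℤ→ℚ-homo‿- x = ℚP.toℚᵘ-injective (begin
  ℚ.toℚᵘ (ℤ→ℚ (ℤ.- x))  ≈⟨ ℚP.toℚᵘ-fromℚᵘ (ℚᵘ.mkℚᵘ (ℤ.- x) 0) ⟩
  ℚᵘ.mkℚᵘ (ℤ.- x) 0     ≈⟨ ℚᵘP.-‿cong (ℚᵘP.≃-sym (ℚP.toℚᵘ-fromℚᵘ (ℚᵘ.mkℚᵘ x 0))) ⟩
  ℚᵘ.- ℚ.toℚᵘ (ℤ→ℚ x)   ≈⟨ ℚᵘP.≃-sym (ℚP.toℚᵘ-homo‿- (ℤ→ℚ x)) ⟩
  ℚ.toℚᵘ (- ℤ→ℚ x)      ∎)
  where open ℚᵘP.≃-Reasoning

ℕ→ℚ-homo-+ : ∀ a b → ℕ→ℚ (a ℕ.+ b) ≡ ℕ→ℚ a + ℕ→ℚ b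
ℕ→ℚ-homo-+ a b = ℤ→ℚ-homo-+ (ℤ.+ a) (ℤ.+ b)

Σᶠ≡sum : ∀ m (f : Fin m → ℚ) → Σᶠ m f ≡ sum f
Σᶠ≡sum zero    f = refl
Σᶠ≡sum (suc m) f = cong (f Fin.zero +_) (Σᶠ≡sum m (f ∘ Fin.suc))

∑-zero : ∀ N {f : Fin N → ℚ} → (∀ i → f i ≡ 0ℚ) → sum f ≡ 0ℚ
∑-zero N f≗0 = trans (sum-cong-≗ f≗0) (sum-replicate-zero N)

∑-neg : ∀ N (f : Fin N → ℚ) → ∑[ i < N ] (- f i) ≡ - sum f
∑-neg zero    f = refl
∑-neg (suc N) f = trans (cong (- f Fin.zero +_) (∑-neg N (f ∘ Fin.suc)))
                        (sym (ℚP.neg-distrib-+ (f Fin.zero) (sum (f ∘ Fin.suc))))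

∑-nonneg : ∀ N {f : Fin N → ℚ} → (∀ i → 0ℚ ℚ.≤ f i) → 0ℚ ℚ.≤ sum f
∑-nonneg zero    f≥0 = ℚP.≤-refl
∑-nonneg (suc N) f≥0 = ℚP.+-mono-≤ (f≥0 Fin.zero) (∑-nonneg N (f≥0 ∘ Fin.suc))

∑-split : ∀ a b (F : ℕ → ℚ) →
          ∑[ i < a ℕ.+ b ] F (toℕ i) ≡ ∑[ i < a ] F (toℕ i) + ∑[ i < b ] F (a ℕ.+ toℕ i)
∑-split zero    b F = sym (ℚP.+-identityˡ _)
∑-split (suc a) b F = trans (cong (F 0 +_) (∑-split a b (F ∘ suc))) (sym (ℚP.+-assoc (F 0) _ _))

∑-const : ∀ N c → ∑[ i < N ] c ≡ ℕ→ℚ N * c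
∑-const zero    c = sym (ℚP.*-zeroˡ c)
∑-const (suc N) c = begin
  c + ∑[ i < N ] c   ≡⟨ cong (c +_) (∑-const N c) ⟩
  c + ℕ→ℚ N * c     ≡⟨ solve 2 (λ c x → c :+ x :* c := (con 1ℚ :+ x) :* c) refl c (ℕ→ℚ N) ⟩
  (1ℚ + ℕ→ℚ N) * c  ≡⟨ cong (_* c) (ℕ→ℚ-homo-+ 1 N) ⟨
  ℕ→ℚ (suc N) * c   ∎
  where open ≡-Reasoning

∑-single : ∀ {N k} (F : ℕ → ℚ) → k ℕ.< N → (∀ i → i ℕ.< N → i ≢ k → F i ≡ 0ℚ) →
           ∑[ i < N ] F (toℕ i) ≡ F k
∑-single {suc N} {zero} F _ vanish =
  trans (cong (F 0 +_) (∑-zero N λ i → vanish (suc (toℕ i)) (s≤s (toℕ<n i)) λ ()))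
        (ℚP.+-identityʳ (F 0))
∑-single {suc N} {suc k} F (s≤s k<N) vanish =
  trans (cong₂ _+_ (vanish 0 (s≤s z≤n) λ ())
                   (∑-single (F ∘ suc) k<N λ i i<N i≢k →
                      vanish (suc i) (s≤s i<N) (i≢k ∘ ℕP.suc-injective)))
        (ℚP.+-identityˡ (F (suc k)))

sumℚ-map-applyUpTo : ∀ N (f : ℕ → ℚ) g → sumℚ (map f (applyUpTo g N)) ≡ ∑[ i < N ] f (g (toℕ i))
sumℚ-map-applyUpTo zero    f g = refl
sumℚ-map-applyUpTo (suc N) f g = cong (f (g 0) +_) (sumℚ-map-applyUpTo N f (g ∘ suc))

-- Positive semidefinite matrices

square-nonneg : ∀ x → 0ℚ ℚ.≤ x * x
square-nonneg x with ℚP.≤-total 0ℚ x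
... | inj₁ x≥0 = ℚP.nonNegative⁻¹ (x * x)
                   {{ℚP.nonNeg*nonNeg⇒nonNeg x {{ℚ.nonNegative x≥0}} x {{ℚ.nonNegative x≥0}}}}
... | inj₂ x≤0 = ℚP.nonNegative⁻¹ (x * x)
                   {{ℚP.nonPos*nonPos⇒nonPos x {{ℚ.nonPositive x≤0}} x {{ℚ.nonPositive x≤0}}}}

*-nonneg : ∀ {x y} → 0ℚ ℚ.≤ x → 0ℚ ℚ.≤ y → 0ℚ ℚ.≤ x * y
*-nonneg {x} {y} x≥0 y≥0 =
  ℚP.nonNegative⁻¹ (x * y) {{ℚP.nonNeg*nonNeg⇒nonNeg x {{ℚ.nonNegative x≥0}} y {{ℚ.nonNegative y≥0}}}}

quadForm≡∑∑ : ∀ {m} (A : Matrix m) x → quadForm A x ≡ ∑[ i < m ] ∑[ j < m ] (x i * (A i j * x j))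
quadForm≡∑∑ {m} A x =
  trans (Σᶠ≡sum m (λ i → Σᶠ m (λ j → x i * (A i j * x j))))
        (sum-cong-≗ λ i → Σᶠ≡sum m (λ j → x i * (A i j * x j)))

quadForm-cong : ∀ {m} {A B : Matrix m} → (∀ i j → A i j ≡ B i j) → ∀ x → quadForm A x ≡ quadForm B x
quadForm-cong {m} {A} {B} A≡B x = begin
  quadForm A x                                ≡⟨ quadForm≡∑∑ A x ⟩
  ∑[ i < m ] ∑[ j < m ] (x i * (A i j * x j))
    ≡⟨ sum-cong-≗ (λ i → sum-cong-≗ λ j → cong (λ a → x i * (a * x j)) (A≡B i j)) ⟩
  ∑[ i < m ] ∑[ j < m ] (x i * (B i j * x j))  ≡⟨ quadForm≡∑∑ B x ⟨
  quadForm B x                                ∎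
  where open ≡-Reasoning

quadForm-+ : ∀ {m} (A B : Matrix m) c x →
             quadForm (λ i j → A i j + c * B i j) x ≡ quadForm A x + c * quadForm B x
quadForm-+ {m} A B c x = begin
  quadForm (λ i j → A i j + c * B i j) x
    ≡⟨ quadForm≡∑∑ (λ i j → A i j + c * B i j) x ⟩
  ∑[ i < m ] ∑[ j < m ] (x i * ((A i j + c * B i j) * x j))
    ≡⟨ sum-cong-≗ (λ i → trans (sum-cong-≗ λ j → distrib (x i) (x j) (A i j) (B i j) c)
                               (∑-distrib-+ (rowA i) (λ j → c * rowB i j))) ⟩
  ∑[ i < m ] (∑[ j < m ] rowA i j + ∑[ j < m ] (c * rowB i j))
    ≡⟨ ∑-distrib-+ (λ i → ∑[ j < m ] rowA i j) (λ i → ∑[ j < m ] (c * rowB i j)) ⟩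
  ∑[ i < m ] ∑[ j < m ] rowA i j + ∑[ i < m ] ∑[ j < m ] (c * rowB i j)
    ≡⟨ cong (∑[ i < m ] ∑[ j < m ] rowA i j +_)
            (trans (sum-cong-≗ λ i → sym (*-distribˡ-sum c (rowB i)))
                   (sym (*-distribˡ-sum c (λ i → ∑[ j < m ] rowB i j)))) ⟩
  ∑[ i < m ] ∑[ j < m ] rowA i j + c * ∑[ i < m ] ∑[ j < m ] rowB i j
    ≡⟨ cong₂ (λ a b → a + c * b) (quadForm≡∑∑ A x) (quadForm≡∑∑ B x) ⟨
  quadForm A x + c * quadForm B x ∎
  where
  open ≡-Reasoning
  rowA rowB : Fin m → Fin m → ℚ
  rowA i j = x i * (A i j * x j)
  rowB i j = x i * (B i j * x j)
  distrib : ∀ xi xj a b c → xi * ((a + c * b) * xj) ≡ xi * (a * xj) + c * (xi * (b * xj))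
  distrib = solve 5 (λ xi xj a b c → xi :* ((a :+ c :* b) :* xj) := xi :* (a :* xj) :+ c :* (xi :* (b :* xj)))
                    refl

gram : ∀ {T m} → (Fin T → Fin m → ℚ) → Matrix m
gram {T} P i j = ∑[ t < T ] (P t i * P t j)

quadForm-gram : ∀ {T m} (P : Fin T → Fin m → ℚ) x →
                quadForm (gram P) x ≡ ∑[ t < T ] ((∑[ i < m ] (P t i * x i)) * (∑[ i < m ] (P t i * x i)))
quadForm-gram {T} {m} P x = begin
  quadForm (gram P) x
    ≡⟨ quadForm≡∑∑ (gram P) x ⟩
  ∑[ i < m ] ∑[ j < m ] (x i * (gram P i j * x j))
    ≡⟨ sum-cong-≗ (λ i → sum-cong-≗ λ j → expand i j) ⟩
  ∑[ i < m ] ∑[ j < m ] ∑[ t < T ] ((P t i * x i) * (P t j * x j))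
    ≡⟨ sum-cong-≗ (λ i → ∑-comm (λ j t → (P t i * x i) * (P t j * x j))) ⟩
  ∑[ i < m ] ∑[ t < T ] ∑[ j < m ] ((P t i * x i) * (P t j * x j))
    ≡⟨ ∑-comm (λ i t → ∑[ j < m ] ((P t i * x i) * (P t j * x j))) ⟩
  ∑[ t < T ] ∑[ i < m ] ∑[ j < m ] ((P t i * x i) * (P t j * x j))
    ≡⟨ sum-cong-≗ (λ t → trans (sum-cong-≗ λ i → sym (*-distribˡ-sum (P t i * x i) (λ j → P t j * x j)))
                               (sym (*-distribʳ-sum (∑[ j < m ] (P t j * x j)) (λ i → P t i * x i)))) ⟩
  ∑[ t < T ] ((∑[ i < m ] (P t i * x i)) * (∑[ i < m ] (P t i * x i))) ∎
  where
  open ≡-Reasoning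
  expand : ∀ i j → x i * (gram P i j * x j) ≡ ∑[ t < T ] ((P t i * x i) * (P t j * x j))
  expand i j = begin
    x i * ((∑[ t < T ] (P t i * P t j)) * x j)
      ≡⟨ cong (x i *_) (*-distribʳ-sum (x j) (λ t → P t i * P t j)) ⟩
    x i * ∑[ t < T ] (P t i * P t j * x j)
      ≡⟨ *-distribˡ-sum (x i) (λ t → P t i * P t j * x j) ⟩
    ∑[ t < T ] (x i * (P t i * P t j * x j))
      ≡⟨ sum-cong-≗ (λ t → rearrange (x i) (x j) (P t i) (P t j)) ⟩
    ∑[ t < T ] ((P t i * x i) * (P t j * x j)) ∎
    where
    rearrange : ∀ xi xj p q → xi * (p * q * xj) ≡ (p * xi) * (q * xj)
    rearrange = solve 4 (λ xi xj p q → xi :* (p :* q :* xj) := (p :* xi) :* (q :* xj)) refl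

IsPSD-gram : ∀ {T m} (P : Fin T → Fin m → ℚ) → IsPSD (gram P)
IsPSD-gram {T} {m} P =
    (λ i j → sum-cong-≗ λ t → ℚP.*-comm (P t i) (P t j))
  , (λ x → subst (0ℚ ℚ.≤_) (sym (quadForm-gram P x))
                 (∑-nonneg T λ t → square-nonneg (∑[ i < m ] (P t i * x i))))

IsPSD-+ : ∀ {m} {A B : Matrix m} {c} → 0ℚ ℚ.≤ c → IsPSD A → IsPSD B → IsPSD (λ i j → A i j + c * B i j)
IsPSD-+ {A = A} {B} {c} c≥0 (A-sym , A≥0) (B-sym , B≥0) =
    (λ i j → cong₂ (λ a b → a + c * b) (A-sym i j) (B-sym i j))
  , (λ x → subst (0ℚ ℚ.≤_) (sym (quadForm-+ A B c x)) (ℚP.+-mono-≤ (A≥0 x) (*-nonneg c≥0 (B≥0 x))))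

IsPSD-cong : ∀ {m} {A B : Matrix m} → (∀ i j → A i j ≡ B i j) → IsPSD A → IsPSD B
IsPSD-cong A≡B (A-sym , A≥0) =
    (λ i j → trans (sym (A≡B i j)) (trans (A-sym i j) (A≡B j i)))
  , (λ x → subst (0ℚ ℚ.≤_) (quadForm-cong A≡B x) (A≥0 x))

-- Signs and the vectors σ

sgn-+ : ∀ p q → sgn (p ℕ.+ q) ≡ sgn p * sgn q
sgn-+ zero    q = sym (ℚP.*-identityˡ (sgn q))
sgn-+ (suc p) q = trans (cong -_ (sgn-+ p q)) (ℚP.neg-distribˡ-* (sgn p) (sgn q))

sgn*sgn≡1 : ∀ p → sgn p * sgn p ≡ 1ℚ
sgn*sgn≡1 zero    = refl
sgn*sgn≡1 (suc p) = trans (solve 1 (λ s → :- s :* :- s := s :* s) refl (sgn p)) (sgn*sgn≡1 p)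

∑-sgn : ∀ N → ∑[ i < N ] sgn (toℕ i) ≡ ½ * (1ℚ - sgn N)
∑-sgn zero    = refl
∑-sgn (suc N) = begin
  1ℚ + ∑[ i < N ] (- sgn (toℕ i))  ≡⟨ cong (1ℚ +_) (trans (∑-neg N (sgn ∘ toℕ)) (cong -_ (∑-sgn N))) ⟩
  1ℚ + - (½ * (1ℚ - sgn N))
    ≡⟨ solve 1 (λ s → con 1ℚ :+ :- (con ½ :* (con 1ℚ :- s)) := con ½ :* (con 1ℚ :- :- s)) refl (sgn N) ⟩
  ½ * (1ℚ - - sgn N)               ∎
  where open ≡-Reasoning

ε : ℕ → ℕ → ℚ
ε a r = if r ≤ᵇ a then 1ℚ else - 1ℚ

σ : ℕ → ℕ → ℚ
σ a r = ε a r * sgn (a ℕ.+ r)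

ε-≤ : ∀ {a r} → r ℕ.≤ a → ε a r ≡ 1ℚ
ε-≤ {a} {r} r≤a = cong (if_then 1ℚ else - 1ℚ) (dec-true (r ℕP.≤? a) r≤a)

ε-> : ∀ {a r} → a ℕ.< r → ε a r ≡ - 1ℚ
ε-> {a} {r} a<r = cong (if_then 1ℚ else - 1ℚ) (dec-false (r ℕP.≤? a) (ℕP.<⇒≱ a<r))

∑σ≡1 : ∀ {μ a} → sgn μ ≡ - 1ℚ → a ℕ.< μ → ∑[ r < μ ] σ a (toℕ r) ≡ 1ℚ
∑σ≡1 {μ} {a} μ-odd a<μ = begin
  ∑[ r < μ ] σ a (toℕ r)
    ≡⟨ cong (λ N → ∑[ r < N ] σ a (toℕ r)) μ≡ ⟨
  ∑[ r < suc a ℕ.+ c ] σ a (toℕ r)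
    ≡⟨ ∑-split (suc a) c (σ a) ⟩
  ∑[ r < suc a ] σ a (toℕ r) + ∑[ i < c ] σ a (suc a ℕ.+ toℕ i)
    ≡⟨ cong₂ _+_ (sum-cong-≗ {suc a} λ r → σ-≤ (ℕP.≤-pred (toℕ<n r))) (sum-cong-≗ {c} λ i → σ-> (toℕ i)) ⟩
  ∑[ r < suc a ] (sgn a * sgn (toℕ r)) + ∑[ i < c ] sgn (toℕ i)
    ≡⟨ cong₂ _+_ (trans (sym (*-distribˡ-sum {suc a} (sgn a) (sgn ∘ toℕ))) (cong (sgn a *_) (∑-sgn (suc a))))
                 (∑-sgn c) ⟩
  sgn a * (½ * (1ℚ - - sgn a)) + ½ * (1ℚ - sgn c)
    ≡⟨ cong (λ s → sgn a * (½ * (1ℚ - - sgn a)) + ½ * (1ℚ - s)) sgn-c ⟩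
  sgn a * (½ * (1ℚ - - sgn a)) + ½ * (1ℚ - sgn a)
    ≡⟨ solve 1 (λ s → s :* (con ½ :* (con 1ℚ :- :- s)) :+ con ½ :* (con 1ℚ :- s) := con ½ :* (s :* s) :+ con ½)
               refl (sgn a) ⟩
  ½ * (sgn a * sgn a) + ½
    ≡⟨ cong (λ s → ½ * s + ½) (sgn*sgn≡1 a) ⟩
  1ℚ ∎
  where
  open ≡-Reasoning
  c = μ ∸ suc a
  μ≡ : suc a ℕ.+ c ≡ μ
  μ≡ = ℕP.m+[n∸m]≡n a<μ
  σ-≤ : ∀ {r} → r ℕ.≤ a → σ a r ≡ sgn a * sgn r
  σ-≤ {r} r≤a = trans (cong (_* sgn (a ℕ.+ r)) (ε-≤ r≤a)) (trans (ℚP.*-identityˡ _) (sgn-+ a r))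
  σ-> : ∀ i → σ a (suc a ℕ.+ i) ≡ sgn i
  σ-> i = begin
    ε a (suc a ℕ.+ i) * sgn (a ℕ.+ (suc a ℕ.+ i))
      ≡⟨ cong₂ _*_ (ε-> (s≤s (ℕP.m≤m+n a i)))
                   (trans (sgn-+ a (suc a ℕ.+ i)) (cong (sgn a *_) (sgn-+ (suc a) i))) ⟩
    - 1ℚ * (sgn a * (- sgn a * sgn i))
      ≡⟨ solve 2 (λ s t → :- con 1ℚ :* (s :* (:- s :* t)) := s :* s :* t) refl (sgn a) (sgn i) ⟩
    sgn a * sgn a * sgn i
      ≡⟨ cong (_* sgn i) (sgn*sgn≡1 a) ⟩
    1ℚ * sgn i
      ≡⟨ ℚP.*-identityˡ (sgn i) ⟩
    sgn i ∎
  sgn-c : sgn c ≡ sgn a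
  sgn-c = begin
    sgn c                            ≡⟨ ℚP.*-identityˡ (sgn c) ⟨
    1ℚ * sgn c                       ≡⟨ cong (_* sgn c) (sgn*sgn≡1 a) ⟨
    sgn a * sgn a * sgn c            ≡⟨ solve 2 (λ s t → s :* s :* t := s :* :- (:- s :* t)) refl (sgn a) (sgn c) ⟩
    sgn a * - (sgn (suc a) * sgn c)  ≡⟨ cong (λ s → sgn a * - s) (sgn-+ (suc a) c) ⟨
    sgn a * - sgn (suc a ℕ.+ c)      ≡⟨ cong (λ N → sgn a * - sgn N) μ≡ ⟩
    sgn a * - sgn μ                  ≡⟨ cong (λ s → sgn a * - s) μ-odd ⟩
    sgn a * - - 1ℚ                   ≡⟨ ℚP.*-identityʳ (sgn a) ⟩
    sgn a                            ∎

σ*σ : ∀ a e r → σ a r * σ (a ℕ.+ e) r ≡ sgn e * (ε a r * ε (a ℕ.+ e) r)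
σ*σ a e r = begin
  ε a r * sgn (a ℕ.+ r) * (ε (a ℕ.+ e) r * sgn (a ℕ.+ e ℕ.+ r))
    ≡⟨ cong₂ (λ x y → ε a r * x * (ε (a ℕ.+ e) r * y))
             (sgn-+ a r) (trans (sgn-+ (a ℕ.+ e) r) (cong (_* sgn r) (sgn-+ a e))) ⟩
  ε a r * (sgn a * sgn r) * (ε (a ℕ.+ e) r * (sgn a * sgn e * sgn r))
    ≡⟨ solve 5 (λ x y s t u → x :* (s :* u) :* (y :* (s :* t :* u)) := t :* (x :* y) :* (s :* s :* (u :* u)))
               refl (ε a r) (ε (a ℕ.+ e) r) (sgn a) (sgn e) (sgn r) ⟩
  sgn e * (ε a r * ε (a ℕ.+ e) r) * (sgn a * sgn a * (sgn r * sgn r))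
    ≡⟨ cong₂ (λ x y → sgn e * (ε a r * ε (a ℕ.+ e) r) * (x * y)) (sgn*sgn≡1 a) (sgn*sgn≡1 r) ⟩
  sgn e * (ε a r * ε (a ℕ.+ e) r) * 1ℚ
    ≡⟨ ℚP.*-identityʳ _ ⟩
  sgn e * (ε a r * ε (a ℕ.+ e) r) ∎
  where open ≡-Reasoning

∑ε*ε : ∀ {μ a e} → a ℕ.+ e ℕ.< μ →
       ∑[ r < μ ] (ε a (toℕ r) * ε (a ℕ.+ e) (toℕ r)) ≡ ℕ→ℚ μ - (ℕ→ℚ e + ℕ→ℚ e)
∑ε*ε {μ} {a} {e} a+e<μ = begin
  ∑[ r < μ ] F (toℕ r)
    ≡⟨ cong (λ N → ∑[ r < N ] F (toℕ r)) μ≡ ⟨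
  ∑[ r < suc a ℕ.+ (e ℕ.+ c) ] F (toℕ r)
    ≡⟨ trans (∑-split (suc a) (e ℕ.+ c) F) (cong (∑[ r < suc a ] F (toℕ r) +_) (∑-split e c (F ∘ (suc a ℕ.+_)))) ⟩
  ∑[ r < suc a ] F (toℕ r) + (∑[ i < e ] F (suc a ℕ.+ toℕ i) + ∑[ i < c ] F (suc a ℕ.+ (e ℕ.+ toℕ i)))
    ≡⟨ cong₂ _+_ (sum-cong-≗ {suc a} λ r → F-≤ (ℕP.≤-pred (toℕ<n r)))
                 (cong₂ _+_ (sum-cong-≗ {e} λ i → F-between (toℕ<n i)) (sum-cong-≗ {c} λ i → F-> (toℕ i))) ⟩
  ∑[ r < suc a ] 1ℚ + (∑[ i < e ] (- 1ℚ) + ∑[ i < c ] 1ℚ)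
    ≡⟨ cong₂ _+_ (∑-const (suc a) 1ℚ) (cong₂ _+_ (∑-const e (- 1ℚ)) (∑-const c 1ℚ)) ⟩
  ℕ→ℚ (suc a) * 1ℚ + (ℕ→ℚ e * - 1ℚ + ℕ→ℚ c * 1ℚ)
    ≡⟨ solve 3 (λ x y z → x :* con 1ℚ :+ (y :* :- con 1ℚ :+ z :* con 1ℚ) := (x :+ (y :+ z)) :- (y :+ y))
               refl (ℕ→ℚ (suc a)) (ℕ→ℚ e) (ℕ→ℚ c) ⟩
  ℕ→ℚ (suc a) + (ℕ→ℚ e + ℕ→ℚ c) - (ℕ→ℚ e + ℕ→ℚ e)
    ≡⟨ cong (_- (ℕ→ℚ e + ℕ→ℚ e))
            (trans (cong (ℕ→ℚ (suc a) +_) (sym (ℕ→ℚ-homo-+ e c))) (sym (ℕ→ℚ-homo-+ (suc a) (e ℕ.+ c)))) ⟩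
  ℕ→ℚ (suc a ℕ.+ (e ℕ.+ c)) - (ℕ→ℚ e + ℕ→ℚ e)
    ≡⟨ cong (λ N → ℕ→ℚ N - (ℕ→ℚ e + ℕ→ℚ e)) μ≡ ⟩
  ℕ→ℚ μ - (ℕ→ℚ e + ℕ→ℚ e) ∎
  where
  open ≡-Reasoning
  F : ℕ → ℚ
  F r = ε a r * ε (a ℕ.+ e) r
  c = μ ∸ suc (a ℕ.+ e)
  μ≡ : suc a ℕ.+ (e ℕ.+ c) ≡ μ
  μ≡ = trans (cong suc (sym (ℕP.+-assoc a e c))) (ℕP.m+[n∸m]≡n a+e<μ)
  F-≤ : ∀ {r} → r ℕ.≤ a → F r ≡ 1ℚ
  F-≤ r≤a = cong₂ _*_ (ε-≤ r≤a) (ε-≤ (ℕP.≤-trans r≤a (ℕP.m≤m+n a e)))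
  F-between : ∀ {i} → i ℕ.< e → F (suc a ℕ.+ i) ≡ - 1ℚ
  F-between {i} i<e = cong₂ _*_ (ε-> (s≤s (ℕP.m≤m+n a i))) (ε-≤ (ℕP.+-monoʳ-< a i<e))
  F-> : ∀ i → F (suc a ℕ.+ (e ℕ.+ i)) ≡ 1ℚ
  F-> i = cong₂ _*_ (ε-> (s≤s (ℕP.m≤m+n a (e ℕ.+ i)))) (ε-> (s≤s (ℕP.+-monoʳ-≤ a (ℕP.m≤m+n e i))))

∑σ*σ : ∀ {μ a e} → a ℕ.+ e ℕ.< μ →
       ∑[ r < μ ] (σ a (toℕ r) * σ (a ℕ.+ e) (toℕ r)) ≡ sgn e * (ℕ→ℚ μ - (ℕ→ℚ e + ℕ→ℚ e))
∑σ*σ {μ} {a} {e} a+e<μ = begin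
  ∑[ r < μ ] (σ a (toℕ r) * σ (a ℕ.+ e) (toℕ r))
    ≡⟨ sum-cong-≗ {μ} (λ r → σ*σ a e (toℕ r)) ⟩
  ∑[ r < μ ] (sgn e * (ε a (toℕ r) * ε (a ℕ.+ e) (toℕ r)))
    ≡⟨ *-distribˡ-sum {μ} (sgn e) (λ r → ε a (toℕ r) * ε (a ℕ.+ e) (toℕ r)) ⟨
  sgn e * ∑[ r < μ ] (ε a (toℕ r) * ε (a ℕ.+ e) (toℕ r))
    ≡⟨ cong (sgn e *_) (∑ε*ε a+e<μ) ⟩
  sgn e * (ℕ→ℚ μ - (ℕ→ℚ e + ℕ→ℚ e)) ∎
  where open ≡-Reasoning

δ : ℕ → ℕ → ℚ
δ t a = indic (t ≡ᵇ a)

δ-refl : ∀ a → δ a a ≡ 1ℚ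
δ-refl a = cong indic (dec-true (a ℕP.≟ a) refl)

δ-≢ : ∀ {t a} → t ≢ a → δ t a ≡ 0ℚ
δ-≢ {t} {a} t≢a = cong indic (dec-false (t ℕP.≟ a) t≢a)

2+h+h≡[1+h]*2 : ∀ h → suc (suc (h ℕ.+ h)) ≡ suc h ℕ.* 2
2+h+h≡[1+h]*2 = ℕ-Solver.solve-∀

-- The helm graph H_n with n = 2h + 2

module HelmLaplacian (h : ℕ) where

  μ : ℕ
  μ = suc (h ℕ.+ h)

  n : ℕ
  n = suc μ

  μ-odd : sgn μ ≡ - 1ℚ
  μ-odd = cong -_ (trans (sgn-+ h h) (sgn*sgn≡1 h))

  onCircle : ℕ → ℕ → ℚ
  onCircle k d = indic ((d ≡ᵇ k) ∨ (d ≡ᵇ (μ ∸ k)))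

  circTerm : ℕ → ℚ → ℚ
  circTerm k x = sgn k * (ℤ→ℚ (ℤ.+ μ ℤ.- ℤ.+ (2 ℕ.* k)) * (½ * x))

  circWeight : ℕ → ℚ
  circWeight d = ∑[ i < h ] circTerm (suc (toℕ i)) (onCircle (suc (toℕ i)) d)

  circPart≡circWeight : ∀ a b → circPart n a b ≡ circWeight ((b ℕ.+ μ ∸ a % μ) % μ)
  circPart≡circWeight a b =
    trans (cong (λ N → sumℚ (map F (applyUpTo suc N))) n/2∸1≡h) (sumℚ-map-applyUpTo h F suc)
    where
    F : ℕ → ℚ
    F k = circTerm k (Cₖ μ k a b)
    n/2∸1≡h : n / 2 ∸ 1 ≡ h
    n/2∸1≡h = cong (_∸ 1) (trans (cong (_/ 2) (2+h+h≡[1+h]*2 h)) (m*n/n≡m (suc h) 2))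

  circCoeff : ℕ → ℚ
  circCoeff k = ½ * (sgn k * (ℕ→ℚ μ - (ℕ→ℚ k + ℕ→ℚ k)))

  circTerm-1 : ∀ k → circTerm k 1ℚ ≡ circCoeff k
  circTerm-1 k = begin
    sgn k * (ℤ→ℚ (ℤ.+ μ ℤ.- ℤ.+ (2 ℕ.* k)) * (½ * 1ℚ))
      ≡⟨ cong (λ x → sgn k * (x * (½ * 1ℚ))) μ-2k ⟩
    sgn k * ((ℕ→ℚ μ - (ℕ→ℚ k + ℕ→ℚ k)) * (½ * 1ℚ))
      ≡⟨ solve 2 (λ s x → s :* (x :* (con ½ :* con 1ℚ)) := con ½ :* (s :* x))
                 refl (sgn k) (ℕ→ℚ μ - (ℕ→ℚ k + ℕ→ℚ k)) ⟩
    circCoeff k ∎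
    where
    open ≡-Reasoning
    μ-2k : ℤ→ℚ (ℤ.+ μ ℤ.- ℤ.+ (2 ℕ.* k)) ≡ ℕ→ℚ μ - (ℕ→ℚ k + ℕ→ℚ k)
    μ-2k = trans (ℤ→ℚ-homo-+ (ℤ.+ μ) (ℤ.- ℤ.+ (2 ℕ.* k)))
                 (cong (ℕ→ℚ μ +_) (trans (ℤ→ℚ-homo‿- (ℤ.+ (2 ℕ.* k)))
                   (cong -_ (trans (cong (λ j → ℕ→ℚ (k ℕ.+ j)) (ℕP.+-identityʳ k)) (ℕ→ℚ-homo-+ k k)))))

  circTerm-0 : ∀ k → circTerm k 0ℚ ≡ 0ℚ
  circTerm-0 k = solve 2 (λ s x → s :* (x :* (con ½ :* con 0ℚ)) := con 0ℚ)
                         refl (sgn k) (ℤ→ℚ (ℤ.+ μ ℤ.- ℤ.+ (2 ℕ.* k)))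

  circCoeff-reflect : ∀ {e} → e ℕ.≤ μ → circCoeff (μ ∸ e) ≡ circCoeff e
  circCoeff-reflect {e} e≤μ = begin
    ½ * (sgn (μ ∸ e) * (ℕ→ℚ μ - (ℕ→ℚ (μ ∸ e) + ℕ→ℚ (μ ∸ e))))
      ≡⟨ cong₂ (λ s x → ½ * (s * (ℕ→ℚ μ - (x + x)))) sgn[μ∸e] ℕ→ℚ[μ∸e] ⟩
    ½ * (- sgn e * (ℕ→ℚ μ - ((ℕ→ℚ μ - ℕ→ℚ e) + (ℕ→ℚ μ - ℕ→ℚ e))))
      ≡⟨ solve 3 (λ s m x → con ½ :* (:- s :* (m :- ((m :- x) :+ (m :- x)))) := con ½ :* (s :* (m :- (x :+ x))))
                 refl (sgn e) (ℕ→ℚ μ) (ℕ→ℚ e) ⟩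
    circCoeff e ∎
    where
    open ≡-Reasoning
    μ≡ : μ ∸ e ℕ.+ e ≡ μ
    μ≡ = ℕP.m∸n+n≡m e≤μ
    ℕ→ℚ[μ∸e] : ℕ→ℚ (μ ∸ e) ≡ ℕ→ℚ μ - ℕ→ℚ e
    ℕ→ℚ[μ∸e] = begin
      ℕ→ℚ (μ ∸ e)                    ≡⟨ solve 2 (λ x y → x := x :+ y :- y) refl (ℕ→ℚ (μ ∸ e)) (ℕ→ℚ e) ⟩
      ℕ→ℚ (μ ∸ e) + ℕ→ℚ e - ℕ→ℚ e    ≡⟨ cong (_- ℕ→ℚ e) (trans (sym (ℕ→ℚ-homo-+ (μ ∸ e) e)) (cong ℕ→ℚ μ≡)) ⟩
      ℕ→ℚ μ - ℕ→ℚ e                  ∎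
    sgn[μ∸e] : sgn (μ ∸ e) ≡ - sgn e
    sgn[μ∸e] = begin
      sgn (μ ∸ e)                    ≡⟨ ℚP.*-identityʳ (sgn (μ ∸ e)) ⟨
      sgn (μ ∸ e) * 1ℚ               ≡⟨ cong (sgn (μ ∸ e) *_) (sgn*sgn≡1 e) ⟨
      sgn (μ ∸ e) * (sgn e * sgn e)  ≡⟨ ℚP.*-assoc (sgn (μ ∸ e)) (sgn e) (sgn e) ⟨
      sgn (μ ∸ e) * sgn e * sgn e    ≡⟨ cong (_* sgn e) (trans (sym (sgn-+ (μ ∸ e) e)) (cong sgn μ≡)) ⟩
      sgn μ * sgn e                  ≡⟨ cong (_* sgn e) μ-odd ⟩
      - 1ℚ * sgn e                   ≡⟨ solve 1 (λ s → :- con 1ℚ :* s := :- s) refl (sgn e) ⟩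
      - sgn e                        ∎

  onCircle-1 : ∀ {k d} → d ≡ k ⊎ d ≡ μ ∸ k → onCircle k d ≡ 1ℚ
  onCircle-1 {k} {d} (inj₁ d≡k)   = cong (λ b → indic (b ∨ (d ≡ᵇ (μ ∸ k)))) (dec-true (d ℕP.≟ k) d≡k)
  onCircle-1 {k} {d} (inj₂ d≡μ∸k) =
    cong indic (trans (cong ((d ≡ᵇ k) ∨_) (dec-true (d ℕP.≟ μ ∸ k) d≡μ∸k)) (∨-zeroʳ (d ≡ᵇ k)))

  onCircle-0 : ∀ {k d} → d ≢ k → d ≢ μ ∸ k → onCircle k d ≡ 0ℚ
  onCircle-0 {k} {d} d≢k d≢μ∸k =
    cong indic (cong₂ _∨_ (dec-false (d ℕP.≟ k) d≢k) (dec-false (d ℕP.≟ μ ∸ k) d≢μ∸k))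

  ≤h⇒≤μ : ∀ {k} → k ℕ.≤ h → k ℕ.≤ μ
  ≤h⇒≤μ k≤h = ℕP.≤-trans k≤h (ℕP.≤-trans (ℕP.m≤m+n h h) (ℕP.n≤1+n (h ℕ.+ h)))

  ≡μ∸⇒+≡μ : ∀ {d k} → k ℕ.≤ μ → d ≡ μ ∸ k → d ℕ.+ k ≡ μ
  ≡μ∸⇒+≡μ k≤μ refl = ℕP.m∸n+n≡m k≤μ

  short-chords : ∀ {k l} → k ℕ.≤ h → l ℕ.≤ h → k ℕ.+ l ≢ μ
  short-chords k≤h l≤h eq = ℕP.n≮n _ (subst (ℕ._≤ h ℕ.+ h) eq (ℕP.+-mono-≤ k≤h l≤h))

  circWeight-single : ∀ {k d} → 1 ℕ.≤ k → k ℕ.≤ h → d ≡ k ⊎ d ≡ μ ∸ k → circWeight d ≡ circCoeff k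
  circWeight-single {suc j} {d} _ j<h d∈ = begin
    circWeight d         ≡⟨ ∑-single F j<h vanish ⟩
    F j                  ≡⟨ cong (circTerm (suc j)) (onCircle-1 d∈) ⟩
    circTerm (suc j) 1ℚ  ≡⟨ circTerm-1 (suc j) ⟩
    circCoeff (suc j)    ∎
    where
    open ≡-Reasoning
    F : ℕ → ℚ
    F i = circTerm (suc i) (onCircle (suc i) d)
    vanish : ∀ i → i ℕ.< h → i ≢ j → F i ≡ 0ℚ
    vanish i i<h i≢j =
      trans (cong (circTerm (suc i)) (onCircle-0 (off d∈) (off-opposite d∈))) (circTerm-0 (suc i))
      where
      off : d ≡ suc j ⊎ d ≡ μ ∸ suc j → d ≢ suc i
      off (inj₁ refl) = i≢j ∘ sym ∘ ℕP.suc-injective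
      off (inj₂ refl) d≡ = short-chords i<h j<h (≡μ∸⇒+≡μ (≤h⇒≤μ j<h) (sym d≡))
      off-opposite : d ≡ suc j ⊎ d ≡ μ ∸ suc j → d ≢ μ ∸ suc i
      off-opposite (inj₁ refl) d≡ = short-chords j<h i<h (≡μ∸⇒+≡μ (≤h⇒≤μ i<h) d≡)
      off-opposite (inj₂ refl) d≡ =
        i≢j (sym (ℕP.suc-injective (ℕP.∸-cancelˡ-≡ (≤h⇒≤μ j<h) (≤h⇒≤μ i<h) d≡)))

  circWeight-0 : circWeight 0 ≡ 0ℚ
  circWeight-0 = ∑-zero h λ i →
    trans (cong (circTerm (suc (toℕ i))) (onCircle-0 {suc (toℕ i)} (λ ()) (0≢ (toℕ<n i))))
          (circTerm-0 (suc (toℕ i)))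
    where
    0≢ : ∀ {i} → i ℕ.< h → 0 ≢ μ ∸ suc i
    0≢ i<h 0≡ = ℕP.<⇒≱ (s≤s (ℕP.≤-trans i<h (ℕP.m≤m+n h h))) (ℕP.m∸n≡0⇒m≤n (sym 0≡))

  circWeight-value : ∀ {d} → 1 ℕ.≤ d → d ℕ.< μ → circWeight d ≡ circCoeff d
  circWeight-value {d} 1≤d d<μ with d ℕP.≤? h
  ... | yes d≤h = circWeight-single 1≤d d≤h (inj₁ refl)
  ... | no d≰h = begin
    circWeight d         ≡⟨ circWeight-single (ℕP.m<n⇒0<n∸m d<μ) μ∸d≤h (inj₂ (sym (ℕP.m∸[m∸n]≡n d≤μ))) ⟩
    circCoeff (μ ∸ d)    ≡⟨ circCoeff-reflect d≤μ ⟩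
    circCoeff d          ∎
    where
    open ≡-Reasoning
    d≤μ : d ℕ.≤ μ
    d≤μ = ℕP.<⇒≤ d<μ
    μ∸d≤h : μ ∸ d ℕ.≤ h
    μ∸d≤h = ℕP.≤-trans (ℕP.∸-monoʳ-≤ μ (ℕP.≰⇒> d≰h)) (ℕP.≤-reflexive (ℕP.m+n∸m≡n h h))

  circWeight-reflect : ∀ {e} → 1 ℕ.≤ e → e ℕ.< μ → circWeight (μ ∸ e) ≡ circWeight e
  circWeight-reflect {e} 1≤e e<μ = begin
    circWeight (μ ∸ e)  ≡⟨ circWeight-value (ℕP.m<n⇒0<n∸m e<μ) (ℕP.∸-monoʳ-< 1≤e (ℕP.<⇒≤ e<μ)) ⟩
    circCoeff (μ ∸ e)   ≡⟨ circCoeff-reflect (ℕP.<⇒≤ e<μ) ⟩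
    circCoeff e         ≡⟨ circWeight-value 1≤e e<μ ⟨
    circWeight e        ∎
    where open ≡-Reasoning

  distance-→ : ∀ a e → a ℕ.+ e ℕ.< μ → (a ℕ.+ e ℕ.+ μ ∸ a % μ) % μ ≡ e
  distance-→ a e a+e<μ = begin
    (a ℕ.+ e ℕ.+ μ ∸ a % μ) % μ
      ≡⟨ cong (λ x → (a ℕ.+ e ℕ.+ μ ∸ x) % μ) (m<n⇒m%n≡m (ℕP.≤-<-trans (ℕP.m≤m+n a e) a+e<μ)) ⟩
    (a ℕ.+ e ℕ.+ μ ∸ a) % μ    ≡⟨ cong (λ x → (x ∸ a) % μ) (ℕP.+-assoc a e μ) ⟩
    (a ℕ.+ (e ℕ.+ μ) ∸ a) % μ  ≡⟨ cong (_% μ) (ℕP.m+n∸m≡n a (e ℕ.+ μ)) ⟩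
    (e ℕ.+ μ) % μ              ≡⟨ [m+n]%n≡m%n e μ ⟩
    e % μ                      ≡⟨ m<n⇒m%n≡m (ℕP.≤-<-trans (ℕP.m≤n+m e a) a+e<μ) ⟩
    e                          ∎
    where open ≡-Reasoning

  distance-← : ∀ b e → 1 ℕ.≤ e → b ℕ.+ e ℕ.< μ → (b ℕ.+ μ ∸ (b ℕ.+ e) % μ) % μ ≡ μ ∸ e
  distance-← b e 1≤e b+e<μ = begin
    (b ℕ.+ μ ∸ (b ℕ.+ e) % μ) % μ  ≡⟨ cong (λ x → (b ℕ.+ μ ∸ x) % μ) (m<n⇒m%n≡m b+e<μ) ⟩
    (b ℕ.+ μ ∸ (b ℕ.+ e)) % μ      ≡⟨ cong (_% μ) (ℕP.[m+n]∸[m+o]≡n∸o b μ e) ⟩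
    (μ ∸ e) % μ
      ≡⟨ m<n⇒m%n≡m (ℕP.∸-monoʳ-< 1≤e (ℕP.<⇒≤ (ℕP.≤-<-trans (ℕP.m≤n+m e b) b+e<μ))) ⟩
    μ ∸ e                          ∎
    where open ≡-Reasoning

  circPart-→ : ∀ a e → a ℕ.+ e ℕ.< μ → circPart n a (a ℕ.+ e) ≡ circWeight e
  circPart-→ a e a+e<μ = trans (circPart≡circWeight a (a ℕ.+ e)) (cong circWeight (distance-→ a e a+e<μ))

  circPart-← : ∀ b e → 1 ℕ.≤ e → b ℕ.+ e ℕ.< μ → circPart n (b ℕ.+ e) b ≡ circWeight e
  circPart-← b e 1≤e b+e<μ = begin
    circPart n (b ℕ.+ e) b                       ≡⟨ circPart≡circWeight (b ℕ.+ e) b ⟩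
    circWeight ((b ℕ.+ μ ∸ (b ℕ.+ e) % μ) % μ)  ≡⟨ cong circWeight (distance-← b e 1≤e b+e<μ) ⟩
    circWeight (μ ∸ e)                           ≡⟨ circWeight-reflect 1≤e (ℕP.≤-<-trans (ℕP.m≤n+m e b) b+e<μ) ⟩
    circWeight e                                 ∎
    where open ≡-Reasoning

  σGram : ℕ → ℕ → ℚ
  σGram a b = ∑[ r < μ ] (σ a (toℕ r) * σ b (toℕ r))

  σGram-→ : ∀ a e → a ℕ.+ e ℕ.< μ →
            σGram a (a ℕ.+ e) ≡ ℕ→ℚ μ * δ a (a ℕ.+ e) + (circWeight e + circWeight e)
  σGram-→ a zero a<μ = begin
    σGram a (a ℕ.+ 0)         ≡⟨ ∑σ*σ {μ} {a} {0} a<μ ⟩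
    1ℚ * (ℕ→ℚ μ - (0ℚ + 0ℚ))
      ≡⟨ solve 1 (λ m → con 1ℚ :* (m :- (con 0ℚ :+ con 0ℚ)) := m :* con 1ℚ :+ (con 0ℚ :+ con 0ℚ)) refl (ℕ→ℚ μ) ⟩
    ℕ→ℚ μ * 1ℚ + (0ℚ + 0ℚ)
      ≡⟨ cong₂ (λ x y → ℕ→ℚ μ * x + (y + y)) (trans (cong (δ a) (ℕP.+-identityʳ a)) (δ-refl a)) circWeight-0 ⟨
    ℕ→ℚ μ * δ a (a ℕ.+ 0) + (circWeight 0 + circWeight 0) ∎
    where open ≡-Reasoning
  σGram-→ a e@(suc _) a+e<μ = begin
    σGram a (a ℕ.+ e)                  ≡⟨ ∑σ*σ {μ} {a} {e} a+e<μ ⟩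
    sgn e * (ℕ→ℚ μ - (ℕ→ℚ e + ℕ→ℚ e))
      ≡⟨ solve 2 (λ m x → x := m :* con 0ℚ :+ (con ½ :* x :+ con ½ :* x))
                 refl (ℕ→ℚ μ) (sgn e * (ℕ→ℚ μ - (ℕ→ℚ e + ℕ→ℚ e))) ⟩
    ℕ→ℚ μ * 0ℚ + (circCoeff e + circCoeff e)
      ≡⟨ cong₂ (λ x y → ℕ→ℚ μ * x + (y + y)) (δ-≢ a≢a+e) (circWeight-value (s≤s z≤n) e<μ) ⟨
    ℕ→ℚ μ * δ a (a ℕ.+ e) + (circWeight e + circWeight e) ∎
    where
    open ≡-Reasoning
    a≢a+e : a ≢ a ℕ.+ e
    a≢a+e eq = ℕP.<-irrefl eq (ℕP.m<m+n a (s≤s z≤n))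
    e<μ : e ℕ.< μ
    e<μ = ℕP.≤-<-trans (ℕP.m≤n+m e a) a+e<μ

  σGram≡circulant : ∀ {a b} → a ℕ.< μ → b ℕ.< μ →
                    σGram a b ≡ ℕ→ℚ μ * δ a b + (circPart n a b + circPart n a b)
  σGram≡circulant {a} {b} a<μ b<μ with a ℕP.≤? b
  ... | yes a≤b = subst (λ b → σGram a b ≡ ℕ→ℚ μ * δ a b + (circPart n a b + circPart n a b))
                        (ℕP.m+[n∸m]≡n a≤b)
                        (trans (σGram-→ a e a+e<μ)
                               (cong (λ x → ℕ→ℚ μ * δ a (a ℕ.+ e) + (x + x)) (sym (circPart-→ a e a+e<μ))))
    where
    e = b ∸ a
    a+e<μ : a ℕ.+ e ℕ.< μ
    a+e<μ = subst (ℕ._< μ) (sym (ℕP.m+[n∸m]≡n a≤b)) b<μ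
  ... | no a≰b = subst (λ a → σGram a b ≡ ℕ→ℚ μ * δ a b + (circPart n a b + circPart n a b))
                       b+e≡a (begin
    σGram (b ℕ.+ e) b
      ≡⟨ sum-cong-≗ {μ} (λ r → ℚP.*-comm (σ (b ℕ.+ e) (toℕ r)) (σ b (toℕ r))) ⟩
    σGram b (b ℕ.+ e)
      ≡⟨ σGram-→ b e b+e<μ ⟩
    ℕ→ℚ μ * δ b (b ℕ.+ e) + (circWeight e + circWeight e)
      ≡⟨ cong₂ (λ x y → ℕ→ℚ μ * x + (y + y)) (trans (δ-≢ (ℕP.<⇒≢ b<b+e)) (sym (δ-≢ (ℕP.>⇒≢ b<b+e))))
                                             (sym (circPart-← b e 1≤e b+e<μ)) ⟩
    ℕ→ℚ μ * δ (b ℕ.+ e) b + (circPart n (b ℕ.+ e) b + circPart n (b ℕ.+ e) b) ∎)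
    where
    open ≡-Reasoning
    b<a : b ℕ.< a
    b<a = ℕP.≰⇒> a≰b
    e = a ∸ b
    b+e≡a : b ℕ.+ e ≡ a
    b+e≡a = ℕP.m+[n∸m]≡n (ℕP.<⇒≤ b<a)
    b+e<μ : b ℕ.+ e ℕ.< μ
    b+e<μ = subst (ℕ._< μ) (sym b+e≡a) a<μ
    b<b+e : b ℕ.< b ℕ.+ e
    b<b+e = subst (b ℕ.<_) (sym b+e≡a) b<a
    1≤e : 1 ℕ.≤ e
    1≤e = ℕP.m<n⇒0<n∸m b<a

  uCoeff : Block → ℚ
  uCoeff hub  = 0ℚ
  uCoeff mid  = - 1ℚ
  uCoeff pend = 1ℚ

  u : ℕ → Block → ℕ → ℚ
  u t β a = uCoeff β * δ t a

  v : ℕ → Block → ℕ → ℚ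
  v r hub  a = 1ℚ
  v r mid  a = - σ a r
  v r pend a = 0ℚ

  ∑u*u : ∀ β γ {a b} → a ℕ.< μ → ∑[ t < μ ] (u (toℕ t) β a * u (toℕ t) γ b) ≡ uCoeff β * uCoeff γ * δ a b
  ∑u*u β γ {a} {b} a<μ = begin
    ∑[ t < μ ] (u (toℕ t) β a * u (toℕ t) γ b)
      ≡⟨ ∑-single (λ t → u t β a * u t γ b) a<μ vanish ⟩
    uCoeff β * δ a a * (uCoeff γ * δ a b)
      ≡⟨ cong (λ x → uCoeff β * x * (uCoeff γ * δ a b)) (δ-refl a) ⟩
    uCoeff β * 1ℚ * (uCoeff γ * δ a b)
      ≡⟨ solve 3 (λ x y d → x :* con 1ℚ :* (y :* d) := x :* y :* d) refl (uCoeff β) (uCoeff γ) (δ a b) ⟩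
    uCoeff β * uCoeff γ * δ a b ∎
    where
    open ≡-Reasoning
    vanish : ∀ t → t ℕ.< μ → t ≢ a → u t β a * u t γ b ≡ 0ℚ
    vanish t _ t≢a = begin
      uCoeff β * δ t a * u t γ b  ≡⟨ cong (λ x → uCoeff β * x * u t γ b) (δ-≢ t≢a) ⟩
      uCoeff β * 0ℚ * u t γ b     ≡⟨ solve 2 (λ x y → x :* con 0ℚ :* y := con 0ℚ) refl (uCoeff β) (u t γ b) ⟩
      0ℚ                          ∎

  vGram : Block → Block → ℕ → ℕ → ℚ
  vGram hub hub a b = ℕ→ℚ μ
  vGram hub mid a b = - 1ℚ
  vGram mid hub a b = - 1ℚ
  vGram mid mid a b = ℕ→ℚ μ * δ a b + (circPart n a b + circPart n a b)
  vGram _   _   a b = 0ℚ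

  ∑-σ≡-1 : ∀ {a} → a ℕ.< μ → ∑[ r < μ ] (- σ a (toℕ r)) ≡ - 1ℚ
  ∑-σ≡-1 {a} a<μ = trans (∑-neg μ (λ r → σ a (toℕ r))) (cong -_ (∑σ≡1 μ-odd a<μ))

  ∑v*v≡vGram : ∀ β γ {a b} → a ℕ.< μ → b ℕ.< μ → ∑[ r < μ ] (v (toℕ r) β a * v (toℕ r) γ b) ≡ vGram β γ a b
  ∑v*v≡vGram hub  hub          _   _   = trans (∑-const μ 1ℚ) (ℚP.*-identityʳ (ℕ→ℚ μ))
  ∑v*v≡vGram hub  mid  {b = b} _   b<μ = trans (sum-cong-≗ {μ} λ r → ℚP.*-identityˡ (- σ b (toℕ r))) (∑-σ≡-1 b<μ)
  ∑v*v≡vGram hub  pend         _   _   = ∑-zero μ λ _ → ℚP.*-zeroʳ 1ℚ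
  ∑v*v≡vGram mid  hub  {a}     a<μ _   = trans (sum-cong-≗ {μ} λ r → ℚP.*-identityʳ (- σ a (toℕ r))) (∑-σ≡-1 a<μ)
  ∑v*v≡vGram mid  mid  {a} {b} a<μ b<μ =
    trans (sum-cong-≗ {μ} λ r → neg*neg (σ a (toℕ r)) (σ b (toℕ r))) (σGram≡circulant a<μ b<μ)
    where
    neg*neg : ∀ x y → - x * - y ≡ x * y
    neg*neg = solve 2 (λ x y → :- x :* :- y := x :* y) refl
  ∑v*v≡vGram mid  pend {a}     _   _   = ∑-zero μ λ r → ℚP.*-zeroʳ (- σ a (toℕ r))
  ∑v*v≡vGram pend hub          _   _   = ∑-zero μ λ _ → ℚP.*-zeroˡ 1ℚ
  ∑v*v≡vGram pend mid  {b = b} _   _   = ∑-zero μ λ r → ℚP.*-zeroˡ (- σ b (toℕ r))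
  ∑v*v≡vGram pend pend         _   _   = ∑-zero μ λ _ → ℚP.*-zeroˡ 0ℚ

  entry≡u+v : ∀ β γ a b →
    ½ * baseEntry n β γ a b + circEntry n β γ a b ≡ uCoeff β * uCoeff γ * δ a b + ½ * vGram β γ a b
  entry≡u+v hub hub a b =
    solve 2 (λ m d → con ½ :* m :+ con 0ℚ := con 0ℚ :* con 0ℚ :* d :+ con ½ :* m) refl (ℕ→ℚ μ) (δ a b)
  entry≡u+v hub mid a b =
    solve 1 (λ d → con ½ :* :- con 1ℚ :+ con 0ℚ := con 0ℚ :* :- con 1ℚ :* d :+ con ½ :* :- con 1ℚ) refl (δ a b)
  entry≡u+v hub pend a b =
    solve 1 (λ d → con ½ :* con 0ℚ :+ con 0ℚ := con 0ℚ :* con 1ℚ :* d :+ con ½ :* con 0ℚ) refl (δ a b)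
  entry≡u+v mid hub a b =
    solve 1 (λ d → con ½ :* :- con 1ℚ :+ con 0ℚ := :- con 1ℚ :* con 0ℚ :* d :+ con ½ :* :- con 1ℚ) refl (δ a b)
  entry≡u+v mid mid a b =
    trans (cong (λ x → ½ * (x * δ a b) + circPart n a b) (ℕ→ℚ-homo-+ 2 μ))
          (solve 3 (λ m d c → con ½ :* ((con (ℕ→ℚ 2) :+ m) :* d) :+ c
                              := :- con 1ℚ :* :- con 1ℚ :* d :+ con ½ :* (m :* d :+ (c :+ c)))
                   refl (ℕ→ℚ μ) (δ a b) (circPart n a b))
  entry≡u+v mid pend a b =
    solve 1 (λ d → con ½ :* :- (con (ℕ→ℚ 2) :* d) :+ con 0ℚ := :- con 1ℚ :* con 1ℚ :* d :+ con ½ :* con 0ℚ)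
            refl (δ a b)
  entry≡u+v pend hub a b =
    solve 1 (λ d → con ½ :* con 0ℚ :+ con 0ℚ := con 1ℚ :* con 0ℚ :* d :+ con ½ :* con 0ℚ) refl (δ a b)
  entry≡u+v pend mid a b =
    solve 1 (λ d → con ½ :* :- (con (ℕ→ℚ 2) :* d) :+ con 0ℚ := con 1ℚ :* :- con 1ℚ :* d :+ con ½ :* con 0ℚ)
            refl (δ a b)
  entry≡u+v pend pend a b =
    solve 1 (λ d → con ½ :* (con (ℕ→ℚ 2) :* d) :+ con 0ℚ := con 1ℚ :* con 1ℚ :* d :+ con ½ :* con 0ℚ)
            refl (δ a b)

  posIn<μ : ∀ i → i ℕ.< suc (μ ℕ.+ μ) → posIn n i ℕ.< μ
  posIn<μ zero    _          = s≤s z≤n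
  posIn<μ (suc i) (s≤s i<2μ) with i <ᵇ μ in eq
  ... | true  = ℕP.<ᵇ⇒< i μ (subst T (sym eq) tt)
  ... | false = subst (i ∸ μ ℕ.<_) (ℕP.m+n∸n≡m μ μ) (ℕP.∸-monoˡ-< i<2μ μ≤i)
    where
    μ≤i : μ ℕ.≤ i
    μ≤i = ℕP.≮⇒≥ (λ i<μ → subst T eq (ℕP.<⇒<ᵇ i<μ))

  dimH≡ : dimH n ≡ suc (μ ℕ.+ μ)
  dimH≡ = trans (ℕP.+-suc μ (μ ℕ.+ 0)) (cong (λ x → suc (μ ℕ.+ x)) (ℕP.+-identityʳ μ))

  U V : Fin μ → Fin (dimH n) → ℚ
  U t i = u (toℕ t) (blockOf n (toℕ i)) (posIn n (toℕ i))
  V r i = v (toℕ r) (blockOf n (toℕ i)) (posIn n (toℕ i))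

  specialLaplacian≡gram : ∀ i j → specialLaplacian n i j ≡ gram U i j + ½ * gram V i j
  specialLaplacian≡gram i j = begin
    specialLaplacian n i j
      ≡⟨ entry≡u+v β γ a b ⟩
    uCoeff β * uCoeff γ * δ a b + ½ * vGram β γ a b
      ≡⟨ cong₂ (λ x y → x + ½ * y) (∑u*u β γ (valid i)) (∑v*v≡vGram β γ (valid i) (valid j)) ⟨
    gram U i j + ½ * gram V i j ∎
    where
    open ≡-Reasoning
    β = blockOf n (toℕ i)
    γ = blockOf n (toℕ j)
    a = posIn n (toℕ i)
    b = posIn n (toℕ j)
    valid : ∀ k → posIn n (toℕ k) ℕ.< μ
    valid k = posIn<μ (toℕ k) (subst (toℕ k ℕ.<_) dimH≡ (toℕ<n k))

  specialLaplacian-isPSD : IsPSD (specialLaplacian n)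
  specialLaplacian-isPSD = IsPSD-cong (λ i j → sym (specialLaplacian≡gram i j))
                                      (IsPSD-+ (ℚP.nonNegative⁻¹ ½) (IsPSD-gram U) (IsPSD-gram V))

mainTheorem4 : (n : ℕ) → 4 ≤ n → 2 ∣ n → IsPSD (specialLaplacian n)
mainTheorem4 _ () (divides zero refl)
mainTheorem4 n _  (divides (suc h) n≡[1+h]*2) =
  subst (IsPSD ∘ specialLaplacian) (trans (2+h+h≡[1+h]*2 h) (sym n≡[1+h]*2))
        (HelmLaplacian.specialLaplacian-isPSD h)
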